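{- Let $w$ be a word and let $\mathit{CST}(w)$ be its Cover Suffix Tree. Let $v$ be an explicit node of $\mathit{CST}(w)$ other than the root, and let $v_1,v_2,\ldots,v_k$ be the consecutive implicit nodes on the edge from $v$ to its explicit parent, ordered so that $|v_i|=|v|-i$. Then for $1\le i\le k$, $$c(v_i)=c(v)-i\,\Delta(v);$$ in particular $(c(v_i))_{i=1}^k$ is an arithmetic progression.
   Context: Let $w$ have length $n$. The suffix tree of $w$ is the compacted trie of the suffixes of $w\#$ ($\#$ a fresh symbol); nodes of the underlying (uncompacted) trie that are kept as nodes of the compacted tree are explicit, the others implicit. For a node $v$ (explicit or implicit), $\hat v$ is the word spelled from the root to $v$ and $|v|=|\hat v|$. $\mathit{Occ}(v,w)$ is the set of starting positions of occurrences of $\hat v$ in $w$; for $i\in\mathit{Occ}(v,w)$, $\delta(i,v)=\min\{y\in\mathit{Occ}(v,w):y>i\}-i$ ($=\infty$ if $i$ is the last occurrence). $c(v)=\mathit{Covered}(\hat v,w)$, the number of positions of $w$ covered by occurrences of $\hat v$, and $\Delta(v)=|\{i\in\mathit{Occ}(v,w):\delta(i,v)\ge|v|\}|$. A word $u$ is primitive if $u=y^k$ implies $y=u$. The Cover Suffix Tree $\mathit{CST}(w)$ is the suffix tree of $w$ in which, additionally, every node $v$ such that $\hat v\hat v$ is a primitively rooted square factor of $w$ is made explicit (extra nodes), and every explicit node $v$ is annotated with the values $c(v)$ and $\Delta(v)$. -}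

module Defs where

open import Data.Nat using (ℕ; zero; suc; _+_; _*_; _∸_; _<_; _≤_; _<?_)
open import Data.List using (List; []; _∷_; _++_; length; take; drop; filter; upTo; [_]; map; concat; replicate)
import Data.List.Properties as LP
open import Data.Maybe using (Maybe; just; nothing)
import Data.Maybe.Properties as MP
open import Data.List.Relation.Unary.Any using (any?)
open import Data.List.Relation.Unary.All using (all?)
open import Data.Product using (Σ; _×_)
open import Data.Sum using (_⊎_)
open import Relation.Nullary using (Dec; ¬_)
open import Relation.Nullary.Decidable using (_×-dec_; ¬?)
open import Relation.Binary.PropositionalEquality using (_≡_; _≢_)
open import Relation.Binary.Definitions using (DecidableEquality)

module _ {B : Set} (eq : DecidableEquality B) where

  OccursAt : List B → List B → ℕ → Set
  OccursAt u x i = take (length u) (drop i x) ≡ u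

  occursAt? : ∀ u x i → Dec (OccursAt u x i)
  occursAt? u x i = LP.≡-dec eq (take (length u) (drop i x)) u

  Occ : List B → List B → List ℕ
  Occ u x = filter (occursAt? u x) (upTo (suc (length x)))

  Covered : List B → List B → ℕ
  Covered u x =
    length (filter
      (λ j → any? (λ i → occursAt? u x i ×-dec (j <? i + length u)) (upTo (suc j)))
      (upTo (length x)))

  -- Δ: number of occurrences i of u with δ(i,u) ≥ |u|, i.e. there is no
  -- occurrence y with i < y < i + |u| (δ = ∞ when there is no later one)
  Delta : List B → List B → ℕ
  Delta u x =
    length (filter
      (λ i → all? (λ y → ¬? ((i <? y) ×-dec occursAt? u x y)) (upTo (i + length u)))
      (Occ u x))

  Factor : List B → List B → Set
  Factor u x = Σ ℕ (λ i → OccursAt u x i)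

  Suffix : List B → List B → Set
  Suffix u x = Σ ℕ (λ i → drop i x ≡ u)

  Primitive : List B → Set
  Primitive u = ∀ (y : List B) (k : ℕ) → concat (replicate (suc k) y) ≡ u → y ≡ u

-- The end marker # is `nothing`; letters of w are `just a`.
-- Nodes of the (uncompacted) suffix trie are identified with the words
-- they spell (factors of w#).

module _ {A : Set} (eqA : DecidableEquality A) where

  eqM : DecidableEquality (Maybe A)
  eqM = MP.≡-dec eqA

  endmarked : List A → List (Maybe A)
  endmarked w = map just w ++ [ nothing ]

  Branching : List A → List (Maybe A) → Set
  Branching w u = Σ (Maybe A) λ a → Σ (Maybe A) λ b →
    a ≢ b × Factor eqM (u ++ [ a ]) (endmarked w) × Factor eqM (u ++ [ b ]) (endmarked w)

  ExplicitST : List A → List (Maybe A) → Set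
  ExplicitST w u = u ≡ [] ⊎ Suffix eqM u (endmarked w) ⊎ Branching w u

  ExtraCST : List A → List (Maybe A) → Set
  ExtraCST w u = Primitive eqM u × Factor eqM (u ++ u) (map just w)

  ExplicitCST : List A → List (Maybe A) → Set
  ExplicitCST w u = ExplicitST w u ⊎ ExtraCST w u

  -- annotations c(v) and Δ(v) (computed in w#, which coincides with w
  -- for #-free nodes)
  cNode : List A → List (Maybe A) → ℕ
  cNode w u = Covered eqM u (endmarked w)

  ΔNode : List A → List (Maybe A) → ℕ
  ΔNode w u = Delta eqM u (endmarked w)

-- Walk up the edge one letter at a time, from u a to u.  Since u is implicit in the suffix tree
-- (neither a leaf nor branching), every occurrence of u extends to one of u a, so both words have
-- the same set O of occurrences.  Shortening the blocks [p, p + |u a|) by one position uncovers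
-- exactly the positions p + |u| with p ∈ O and no other occurrence in (p, p + |u|], so c drops by
-- Δ(u a).  And Δ does not change, because two consecutive occurrences of u a at distance exactly |u|
-- would make the square u u a factor of w with u primitive (a shorter root y of u would put a further
-- occurrence of u a at distance |y|), i.e. u would be an extra node of the CST.  Summing over the
-- i letters between v_i and v gives c(v_i) = c(v) − i Δ(v).

module Submission where

open import Level using (0ℓ)
open import Data.Nat using (ℕ; zero; suc; _+_; _*_; _∸_; _≤_; _<_; _<?_; z≤n; s≤s)
open import Data.Nat.Properties
open import Data.List using (List; []; _∷_; _++_; [_]; length; filter; upTo; take; drop; concat; replicate; map)
open import Data.List.Properties
  using ( filter-≐; filter-++; length-++; length-drop; upTo-∷ʳ; take-[]; drop-[]; drop-drop; take++drop≡id
        ; ++-assoc; ++-identityʳ; ++-conicalˡ; ++-conicalʳ; ++-cancelˡ; ∷-injective; ∷-injectiveˡ)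
open import Data.List.Relation.Unary.Any as Any using (Any; any?)
open import Data.List.Relation.Unary.All as All using (All; all?)
open import Data.List.Membership.Propositional using (find; lose)
open import Data.List.Membership.Propositional.Properties using (∈-upTo⁺; ∈-upTo⁻)
open import Data.Maybe using (Maybe; just; nothing)
open import Data.Product using (_×_; _,_; proj₁; proj₂; ∃-syntax; map₁; map₂)
open import Data.Sum using (inj₁; inj₂)
open import Data.Empty using (⊥-elim)
open import Function using (_∘_)
open import Relation.Nullary using (¬_; yes; no)
open import Relation.Nullary.Decidable using (_×-dec_; ¬?)
open import Relation.Unary using (Pred; Decidable; _≐_; _⊆_; _∩_)
open import Relation.Unary.Properties using (_∩?_; ∁?)
open import Relation.Binary.PropositionalEquality hiding ([_])
open import Relation.Binary.Definitions using (DecidableEquality)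
open import Defs

module _ {A : Set} {P Q : Pred A 0ℓ} (P? : Decidable P) (Q? : Decidable Q) where

  filter-filter : ∀ xs → filter Q? (filter P? xs) ≡ filter (P? ∩? Q?) xs
  filter-filter [] = refl
  filter-filter (x ∷ xs) with P? x
  ... | no _ = filter-filter xs
  ... | yes _ with Q? x
  ...   | yes _ = cong (x ∷_) (filter-filter xs)
  ...   | no  _ = filter-filter xs

module _ {P : Pred ℕ 0ℓ} (P? : Decidable P) where

  count : ℕ → ℕ
  count zero = 0
  count (suc n) with P? n
  ... | yes _ = suc (count n)
  ... | no  _ = count n

  length-filter-upTo : ∀ n → length (filter P? (upTo n)) ≡ count n
  length-filter-upTo zero = refl
  length-filter-upTo (suc n) = begin
    length (filter P? (upTo (suc n)))                    ≡⟨ cong (length ∘ filter P?) (sym (upTo-∷ʳ n)) ⟩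
    length (filter P? (upTo n ++ [ n ]))                 ≡⟨ cong length (filter-++ P? (upTo n) [ n ]) ⟩
    length (filter P? (upTo n) ++ filter P? [ n ])       ≡⟨ length-++ (filter P? (upTo n)) ⟩
    length (filter P? (upTo n)) + length (filter P? [ n ]) ≡⟨ cong (_+ length (filter P? [ n ])) (length-filter-upTo n) ⟩
    count n + length (filter P? [ n ])                   ≡⟨ last-step ⟩
    count (suc n)                                        ∎
    where
    open ≡-Reasoning
    last-step : count n + length (filter P? [ n ]) ≡ count (suc n)
    last-step with P? n
    ... | yes _ = +-comm (count n) 1
    ... | no  _ = +-identityʳ (count n)

  count-stable : ∀ {a b} → a ≤ b → (∀ k → a ≤ k → k < b → ¬ P k) → count b ≡ count a
  count-stable {b = zero} z≤n _ = refl
  count-stable {a} {suc b} a≤1+b none with m≤n⇒m<n∨m≡n a≤1+b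
  ... | inj₂ refl = refl
  ... | inj₁ (s≤s a≤b) with P? b
  ...   | yes Pb = ⊥-elim (none b a≤b ≤-refl Pb)
  ...   | no  _  = count-stable a≤b (λ k a≤k k<b → none k a≤k (m≤n⇒m≤1+n k<b))

module _ {P Q : Pred ℕ 0ℓ} (P? : Decidable P) (Q? : Decidable Q) where

  count-≐ : P ≐ Q → ∀ n → count P? n ≡ count Q? n
  count-≐ P≐Q n = begin
    count P? n                   ≡⟨ sym (length-filter-upTo P? n) ⟩
    length (filter P? (upTo n))  ≡⟨ cong length (filter-≐ P? Q? P≐Q (upTo n)) ⟩
    length (filter Q? (upTo n))  ≡⟨ length-filter-upTo Q? n ⟩
    count Q? n                   ∎
    where open ≡-Reasoning

  count-partition : ∀ n → count P? n ≡ count (P? ∩? Q?) n + count (P? ∩? ∁? Q?) n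
  count-partition zero = refl
  count-partition (suc n) with P? n | Q? n | count-partition n
  ... | yes _ | yes _ | ih = cong suc ih
  ... | yes _ | no  _ | ih = trans (cong suc ih) (sym (+-suc _ _))
  ... | no  _ | _     | ih = ih

  count-shift : ∀ ℓ → (λ t → P (t + ℓ)) ≐ Q → ∀ m → count P? (m + ℓ) ≡ count P? ℓ + count Q? m
  count-shift ℓ _ zero = sym (+-identityʳ _)
  count-shift ℓ P≐Q (suc m) with P? (m + ℓ) | Q? m | count-shift ℓ P≐Q m
  ... | yes _  | yes _  | ih = trans (cong suc ih) (sym (+-suc _ _))
  ... | no  _  | no  _  | ih = ih
  ... | yes Pt | no ¬Qm | _  = ⊥-elim (¬Qm (proj₁ P≐Q Pt))
  ... | no ¬Pt | yes Qm | _  = ⊥-elim (¬Pt (proj₂ P≐Q Qm))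

-- O plays the set of occurrences of a word of length ℓ.  Covered u x and Delta u x of Defs are,
-- definitionally, coverCount (occursAt? u x) |u| |x| and isolatedCount (occursAt? u x) |u| (1 + |x|);
-- Isolated ℓ i says that δ(i) ≥ ℓ.
module Positions {O : Pred ℕ 0ℓ} (O? : Decidable O) where

  CoveredBy : ℕ → Pred ℕ 0ℓ
  CoveredBy ℓ j = Any (λ i → O i × j < i + ℓ) (upTo (suc j))

  coveredBy? : ∀ ℓ → Decidable (CoveredBy ℓ)
  coveredBy? ℓ j = any? (λ i → O? i ×-dec (j <? i + ℓ)) (upTo (suc j))

  coverCount : ℕ → ℕ → ℕ
  coverCount ℓ n = length (filter (coveredBy? ℓ) (upTo n))

  Isolated : ℕ → Pred ℕ 0ℓ
  Isolated ℓ i = All (λ y → ¬ (i < y × O y)) (upTo (i + ℓ))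

  isolated? : ∀ ℓ → Decidable (Isolated ℓ)
  isolated? ℓ i = all? (λ y → ¬? ((i <? y) ×-dec O? y)) (upTo (i + ℓ))

  isolatedCount : ℕ → ℕ → ℕ
  isolatedCount ℓ N = length (filter (isolated? ℓ) (filter O? (upTo N)))

  coveredBy⁺ : ∀ {ℓ j p} → p ≤ j → O p → j < p + ℓ → CoveredBy ℓ j
  coveredBy⁺ p≤j Op j<p+ℓ = lose (∈-upTo⁺ (s≤s p≤j)) (Op , j<p+ℓ)

  coveredBy⁻ : ∀ {ℓ j} → CoveredBy ℓ j → ∃[ p ] p ≤ j × O p × j < p + ℓ
  coveredBy⁻ c with find c
  ... | p , p∈ , Op , j<p+ℓ = p , ≤-pred (∈-upTo⁻ p∈) , Op , j<p+ℓ

  isolated⁺ : ∀ {ℓ i} → (∀ {y} → i < y → y < i + ℓ → ¬ O y) → Isolated ℓ i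
  isolated⁺ gap = All.tabulate λ y∈ (i<y , Oy) → gap i<y (∈-upTo⁻ y∈) Oy

  isolated⁻ : ∀ {ℓ i y} → Isolated ℓ i → i < y → y < i + ℓ → ¬ O y
  isolated⁻ iso i<y y<i+ℓ Oy = All.lookup iso (∈-upTo⁺ y<i+ℓ) (i<y , Oy)

  private
    <-+-suc : ∀ {j} i ℓ → j < i + ℓ → j < i + suc ℓ
    <-+-suc i ℓ j<i+ℓ = ≤-trans j<i+ℓ (+-monoʳ-≤ i (n≤1+n ℓ))

  coveredBy-suc : ∀ {ℓ} → CoveredBy ℓ ⊆ CoveredBy (suc ℓ)
  coveredBy-suc = Any.map λ {i} (Oi , j<i+ℓ) → Oi , <-+-suc i _ j<i+ℓ

  isolated-pred : ∀ {ℓ} → Isolated (suc ℓ) ⊆ Isolated ℓ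
  isolated-pred {ℓ} {i} iso = isolated⁺ λ i<y y<i+ℓ → isolated⁻ iso i<y (<-+-suc i ℓ y<i+ℓ)

  newlyCovered⁻ : ∀ {ℓ j} → CoveredBy (suc ℓ) j → ¬ CoveredBy ℓ j →
                  ∃[ t ] j ≡ t + ℓ × O t × Isolated (suc ℓ) t
  newlyCovered⁻ {ℓ} {j} c ¬c with coveredBy⁻ c
  ... | t , t≤j , Ot , j<t+1+ℓ = t , j≡t+ℓ , Ot , isolated⁺ gap
    where
    j≤t+ℓ : j ≤ t + ℓ
    j≤t+ℓ = ≤-pred (subst (j <_) (+-suc t ℓ) j<t+1+ℓ)
    j≡t+ℓ : j ≡ t + ℓ
    j≡t+ℓ = ≤-antisym j≤t+ℓ (≮⇒≥ λ j<t+ℓ → ¬c (coveredBy⁺ t≤j Ot j<t+ℓ))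
    gap : ∀ {y} → t < y → y < t + suc ℓ → ¬ O y
    gap {y} t<y y<t+1+ℓ Oy = ¬c (coveredBy⁺ y≤j Oy (subst (_< y + ℓ) (sym j≡t+ℓ) (+-monoˡ-< ℓ t<y)))
      where
      y≤j : y ≤ j
      y≤j = subst (y ≤_) (sym j≡t+ℓ) (≤-pred (subst (y <_) (+-suc t ℓ) y<t+1+ℓ))

  newlyCovered⁺ : ∀ {ℓ t} → O t → Isolated (suc ℓ) t → CoveredBy (suc ℓ) (t + ℓ) × ¬ CoveredBy ℓ (t + ℓ)
  newlyCovered⁺ {ℓ} {t} Ot iso = coveredBy⁺ (m≤m+n t ℓ) Ot t+ℓ<t+1+ℓ , ¬c
    where
    t+ℓ<t+1+ℓ : t + ℓ < t + suc ℓ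
    t+ℓ<t+1+ℓ = +-monoʳ-< t ≤-refl
    ¬c : ¬ CoveredBy ℓ (t + ℓ)
    ¬c c with coveredBy⁻ c
    ... | p , p≤t+ℓ , Op , t+ℓ<p+ℓ = isolated⁻ iso (+-cancelʳ-< ℓ t p t+ℓ<p+ℓ) (≤-<-trans p≤t+ℓ t+ℓ<t+1+ℓ) Op

  coverCount-suc : ∀ ℓ {n N} → (∀ {p} → O p → p + suc ℓ ≤ n) → n ≤ N →
                   coverCount (suc ℓ) n ≡ coverCount ℓ n + isolatedCount (suc ℓ) N
  coverCount-suc ℓ {n} {N} bound n≤N = begin
    coverCount (suc ℓ) n                          ≡⟨ length-filter-upTo C₊? n ⟩
    count C₊? n                                   ≡⟨ count-partition C₊? C? n ⟩
    count (C₊? ∩? C?) n + count New? n            ≡⟨ cong₂ _+_ (count-≐ (C₊? ∩? C?) C? (proj₂ , λ c → coveredBy-suc c , c) n)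
                                                               (sym (count-stable New? (≤-trans n≤N (m≤m+n N ℓ)) beyond)) ⟩
    count C? n + count New? (N + ℓ)               ≡⟨ cong₂ _+_ (sym (length-filter-upTo C? n)) (count-shift New? I? ℓ shifted N) ⟩
    coverCount ℓ n + (count New? ℓ + count I? N)  ≡⟨ cong (λ k → coverCount ℓ n + (k + count I? N)) (count-stable New? z≤n below) ⟩
    coverCount ℓ n + count I? N                   ≡⟨ cong (coverCount ℓ n +_) (sym isolatedCount≡count) ⟩
    coverCount ℓ n + isolatedCount (suc ℓ) N      ∎
    where
    open ≡-Reasoning
    C₊? = coveredBy? (suc ℓ)
    C?  = coveredBy? ℓ
    New? = C₊? ∩? ∁? C?
    I? = O? ∩? isolated? (suc ℓ)

    beyond : ∀ j → n ≤ j → j < N + ℓ → ¬ (CoveredBy (suc ℓ) j × ¬ CoveredBy ℓ j)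
    beyond j n≤j _ (c , ¬c) with newlyCovered⁻ c ¬c
    ... | t , refl , Ot , _ = <⇒≱ (subst (_≤ n) (+-suc t ℓ) (bound Ot)) n≤j

    below : ∀ j → 0 ≤ j → j < ℓ → ¬ (CoveredBy (suc ℓ) j × ¬ CoveredBy ℓ j)
    below j _ j<ℓ (c , ¬c) with newlyCovered⁻ c ¬c
    ... | t , refl , _ = <⇒≱ j<ℓ (m≤n+m ℓ t)

    shifted : (λ t → CoveredBy (suc ℓ) (t + ℓ) × ¬ CoveredBy ℓ (t + ℓ)) ≐ (O ∩ Isolated (suc ℓ))
    shifted = to , λ (Ot , iso) → newlyCovered⁺ Ot iso
      where
      to : ∀ {t} → CoveredBy (suc ℓ) (t + ℓ) × ¬ CoveredBy ℓ (t + ℓ) → O t × Isolated (suc ℓ) t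
      to {t} (c , ¬c) with newlyCovered⁻ c ¬c
      ... | t′ , t+ℓ≡t′+ℓ , Ot′ , iso with +-cancelʳ-≡ ℓ t t′ t+ℓ≡t′+ℓ
      ... | refl = Ot′ , iso

    isolatedCount≡count : isolatedCount (suc ℓ) N ≡ count I? N
    isolatedCount≡count = trans (cong length (filter-filter O? (isolated? (suc ℓ)) (upTo N))) (length-filter-upTo I? N)

  isolatedCount-suc : ∀ ℓ N → (∀ {p} → O p → Isolated ℓ p → ¬ O (p + ℓ)) →
                      isolatedCount (suc ℓ) N ≡ isolatedCount ℓ N
  isolatedCount-suc ℓ N noAdjacent = cong length (begin
    filter (isolated? (suc ℓ)) (filter O? (upTo N)) ≡⟨ filter-filter O? (isolated? (suc ℓ)) (upTo N) ⟩
    filter (O? ∩? isolated? (suc ℓ)) (upTo N)       ≡⟨ filter-≐ _ _ (map₂ isolated-pred , widen) (upTo N) ⟩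
    filter (O? ∩? isolated? ℓ) (upTo N)             ≡⟨ sym (filter-filter O? (isolated? ℓ) (upTo N)) ⟩
    filter (isolated? ℓ) (filter O? (upTo N))       ∎)
    where
    open ≡-Reasoning
    widen : O ∩ Isolated ℓ ⊆ O ∩ Isolated (suc ℓ)
    widen {p} (Op , iso) = Op , isolated⁺ gap
      where
      gap : ∀ {y} → p < y → y < p + suc ℓ → ¬ O y
      gap {y} p<y y<p+1+ℓ with m≤n⇒m<n∨m≡n (≤-pred (subst (y <_) (+-suc p ℓ) y<p+1+ℓ))
      ... | inj₁ y<p+ℓ = isolated⁻ iso p<y y<p+ℓ
      ... | inj₂ refl  = noAdjacent Op iso

module _ {O O′ : Pred ℕ 0ℓ} (O? : Decidable O) (O′? : Decidable O′) (O≐O′ : O ≐ O′) where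
  open Positions

  coverCount-≐ : ∀ ℓ n → coverCount O? ℓ n ≡ coverCount O′? ℓ n
  coverCount-≐ ℓ n = cong length (filter-≐ (coveredBy? O? ℓ) (coveredBy? O′? ℓ)
    (Any.map (map₁ (proj₁ O≐O′)) , Any.map (map₁ (proj₂ O≐O′))) (upTo n))

  isolatedCount-≐ : ∀ ℓ N → isolatedCount O? ℓ N ≡ isolatedCount O′? ℓ N
  isolatedCount-≐ ℓ N = cong length (trans
    (cong (filter (isolated? O? ℓ)) (filter-≐ O? O′? O≐O′ (upTo N)))
    (filter-≐ (isolated? O? ℓ) (isolated? O′? ℓ) (All.map (_∘ map₂ (proj₂ O≐O′)) , All.map (_∘ map₂ (proj₁ O≐O′))) (filter O′? (upTo N))))

m∸[n∸o]≡m∸n+o : ∀ {m n o} → o ≤ n → n ≤ m → m ∸ (n ∸ o) ≡ m ∸ n + o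
m∸[n∸o]≡m∸n+o {m} {n} {o} o≤n n≤m = begin
  m ∸ (n ∸ o)                ≡⟨ cong (_∸ (n ∸ o)) (m∸n+n≡m n≤m) ⟨
  (m ∸ n + n) ∸ (n ∸ o)      ≡⟨ +-∸-assoc (m ∸ n) (m∸n≤m n o) ⟩
  m ∸ n + (n ∸ (n ∸ o))      ≡⟨ cong (m ∸ n +_) (m∸[m∸n]≡n o≤n) ⟩
  m ∸ n + o                  ∎
  where open ≡-Reasoning

module _ {B : Set} where

  take-length-++ : ∀ (u r : List B) → take (length u) (u ++ r) ≡ u
  take-length-++ []      r = refl
  take-length-++ (c ∷ u) r = cong (c ∷_) (take-length-++ u r)

  drop-length-++ : ∀ (u r : List B) → drop (length u) (u ++ r) ≡ r
  drop-length-++ []      r = refl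
  drop-length-++ (c ∷ u) r = drop-length-++ u r

  take-+ : ∀ m n (v : List B) → take (m + n) v ≡ take m v ++ take n (drop m v)
  take-+ zero    n v       = refl
  take-+ (suc m) n []      = sym (take-[] n)
  take-+ (suc m) n (c ∷ v) = cong (c ∷_) (take-+ m n v)

  power-comm : ∀ n (y : List B) → concat (replicate n y) ++ y ≡ y ++ concat (replicate n y)
  power-comm zero    y = sym (++-identityʳ y)
  power-comm (suc n) y = trans (++-assoc y _ y) (cong (y ++_) (power-comm n y))

  power-[] : ∀ n → concat {A = B} (replicate n []) ≡ []
  power-[] zero    = refl
  power-[] (suc n) = power-[] n

module _ {B : Set} (eq : DecidableEquality B) where

  occursAt⁻ : ∀ {u} z i → OccursAt eq u z i → ∃[ r ] drop i z ≡ u ++ r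
  occursAt⁻ {u} z i o = drop (length u) (drop i z) ,
    trans (sym (take++drop≡id (length u) (drop i z))) (cong (_++ drop (length u) (drop i z)) o)

  occursAt⁺ : ∀ {u r} z i → drop i z ≡ u ++ r → OccursAt eq u z i
  occursAt⁺ {u} {r} z i e = trans (cong (take (length u)) e) (take-length-++ u r)

  occursAt-prefix : ∀ u {s} z i → OccursAt eq (u ++ s) z i → OccursAt eq u z i
  occursAt-prefix u {s} z i o with occursAt⁻ z i o
  ... | r , e = occursAt⁺ z i (trans e (++-assoc u s r))

  occursAt-++ : ∀ {u s} z i → OccursAt eq u z i → OccursAt eq s z (i + length u) → OccursAt eq (u ++ s) z i
  occursAt-++ {u} {s} z i o₁ o₂ with occursAt⁻ z i o₁ | occursAt⁻ z (i + length u) o₂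
  ... | r₁ , e₁ | r₂ , e₂ = occursAt⁺ z i (begin
    drop i z        ≡⟨ e₁ ⟩
    u ++ r₁         ≡⟨ cong (u ++_) r₁≡s++r₂ ⟩
    u ++ s ++ r₂    ≡⟨ ++-assoc u s r₂ ⟨
    (u ++ s) ++ r₂  ∎)
    where
    open ≡-Reasoning
    r₁≡s++r₂ : r₁ ≡ s ++ r₂
    r₁≡s++r₂ = begin
      r₁                          ≡⟨ drop-length-++ u r₁ ⟨
      drop (length u) (u ++ r₁)   ≡⟨ cong (drop (length u)) e₁ ⟨
      drop (length u) (drop i z)  ≡⟨ drop-drop i (length u) z ⟩
      drop (i + length u) z       ≡⟨ e₂ ⟩
      s ++ r₂                     ∎

  occursAt-++ʳ : ∀ {u} z z′ i → OccursAt eq u z i → OccursAt eq u (z ++ z′) i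
  occursAt-++ʳ {u} z z′ i o = occursAt⁺ (z ++ z′) i (proj₂ (extend z i (occursAt⁻ z i o)))
    where
    extend : ∀ z i → ∃[ r ] drop i z ≡ u ++ r → ∃[ r ] drop i (z ++ z′) ≡ u ++ r
    extend z       zero    (r , e) = r ++ z′ , trans (cong (_++ z′) e) (++-assoc u r z′)
    extend []      (suc i) (r , e) with ++-conicalˡ u r (sym e)
    ... | refl = drop (suc i) z′ , refl
    extend (c ∷ z) (suc i) e = extend z i e

  occursAt-∷ʳ⁻ : ∀ {u c d} z i → OccursAt eq (u ++ [ c ]) (z ++ [ d ]) i → OccursAt eq u z i
  occursAt-∷ʳ⁻ {u} {c} {d} z i o = occursAt⁺ z i (proj₂ (shorten z i (occursAt⁻ (z ++ [ d ]) i o)))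
    where
    init : ∀ u z {r} → z ++ [ d ] ≡ (u ++ [ c ]) ++ r → ∃[ r′ ] z ≡ u ++ r′
    init []          z       _ = z , refl
    init (a ∷ [])    []      ()
    init (a ∷ b ∷ u) []      ()
    init (a ∷ u)     (b ∷ z) e with ∷-injective e
    ... | refl , e′ = map₂ (cong (a ∷_)) (init u z e′)
    shorten : ∀ z i → ∃[ r ] drop i (z ++ [ d ]) ≡ (u ++ [ c ]) ++ r → ∃[ r ] drop i z ≡ u ++ r
    shorten z       zero    (r , e) = init u z e
    shorten []      (suc i) (r , e) with ++-conicalʳ u [ c ] (++-conicalˡ (u ++ [ c ]) r (sym (trans (sym (drop-[] i)) e)))
    ... | ()
    shorten (b ∷ z) (suc i) e = shorten z i e

  occursAt-bound : ∀ {u} z i → OccursAt eq u z i → 0 < length u → i + length u ≤ length z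
  occursAt-bound {u} z i o 0<|u| with occursAt⁻ z i o
  ... | r , e = subst (_≤ length z) (+-comm (length u) i) (m≤o∸n⇒m+n≤o (length u) i≤|z| |u|≤|z|∸i)
    where
    open ≤-Reasoning
    |u|≤|z|∸i : length u ≤ length z ∸ i
    |u|≤|z|∸i = begin
      length u             ≤⟨ m≤m+n (length u) (length r) ⟩
      length u + length r  ≡⟨ length-++ u ⟨
      length (u ++ r)      ≡⟨ cong length e ⟨
      length (drop i z)    ≡⟨ length-drop i z ⟩
      length z ∸ i         ∎
    i≤|z| : i ≤ length z
    i≤|z| = <⇒≤ (m∸n≢0⇒n<m λ |z|∸i≡0 → <⇒≱ 0<|u| (subst (length u ≤_) |z|∸i≡0 |u|≤|z|∸i))

  occursAt-power-shift : ∀ {a} z t c y k → let y⁺ = c ∷ y; u = concat (replicate (suc (suc k)) y⁺) in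
    OccursAt eq (u ++ [ a ]) z t → OccursAt eq (u ++ [ a ]) z (t + length u) →
    OccursAt eq (u ++ [ a ]) z (t + length y⁺)
  occursAt-power-shift {a} z t c y k o₁ o₂
    with occursAt⁻ z t o₁ | occursAt⁻ z t (occursAt-++ z t (occursAt-prefix (concat (replicate (suc (suc k)) (c ∷ y))) z t o₁) o₂)
  ... | r₁ , e₁ | r , e =
    subst (λ b → OccursAt eq (u ++ [ b ]) z (t + length y⁺)) (sym a≡c) (occursAt⁺ z (t + length y⁺) shifted)
    where
    open ≡-Reasoning
    y⁺ = c ∷ y
    q = y ++ concat (replicate k y⁺)
    p = c ∷ q
    u = y⁺ ++ p

    a≡c : a ≡ c
    a≡c = ∷-injectiveˡ (++-cancelˡ u (a ∷ r₁) ((u ++ [ a ]) ++ r) (begin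
      u ++ a ∷ r₁             ≡⟨ ++-assoc u [ a ] r₁ ⟨
      (u ++ [ a ]) ++ r₁      ≡⟨ e₁ ⟨
      drop t z                ≡⟨ e ⟩
      (u ++ u ++ [ a ]) ++ r  ≡⟨ ++-assoc u (u ++ [ a ]) r ⟩
      u ++ (u ++ [ a ]) ++ r  ∎))

    shifted : drop (t + length y⁺) z ≡ (u ++ [ c ]) ++ q ++ a ∷ r
    shifted = begin
      drop (t + length y⁺) z                    ≡⟨ drop-drop t (length y⁺) z ⟨
      drop (length y⁺) (drop t z)               ≡⟨ cong (drop (length y⁺)) e ⟩
      drop (length y⁺) ((u ++ u ++ [ a ]) ++ r) ≡⟨ cong (drop (length y⁺)) (trans (++-assoc u (u ++ [ a ]) r) (++-assoc y⁺ p _)) ⟩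
      drop (length y⁺) (y⁺ ++ p ++ (u ++ [ a ]) ++ r) ≡⟨ drop-length-++ y⁺ _ ⟩
      p ++ (u ++ [ a ]) ++ r                    ≡⟨ cong (p ++_) (trans (++-assoc u [ a ] r) (++-assoc y⁺ p (a ∷ r))) ⟩
      p ++ y⁺ ++ p ++ a ∷ r                     ≡⟨ ++-assoc p y⁺ _ ⟨
      (p ++ y⁺) ++ p ++ a ∷ r                   ≡⟨ cong (_++ p ++ a ∷ r) (power-comm (suc k) y⁺) ⟩
      u ++ c ∷ q ++ a ∷ r                       ≡⟨ ++-assoc u [ c ] _ ⟨
      (u ++ [ c ]) ++ q ++ a ∷ r                ∎

  adjacent⇒primitive : ∀ {u a} z t → OccursAt eq (u ++ [ a ]) z t → OccursAt eq (u ++ [ a ]) z (t + length u) →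
                       (∀ {y} → t < y → y < t + length u → ¬ OccursAt eq (u ++ [ a ]) z y) → Primitive eq u
  adjacent⇒primitive z t o₁ o₂ gap y       zero    e    = trans (sym (++-identityʳ y)) e
  adjacent⇒primitive z t o₁ o₂ gap []      (suc k) e    = trans (sym (power-[] (suc (suc k)))) e
  adjacent⇒primitive z t o₁ o₂ gap (c ∷ y) (suc k) refl =
    ⊥-elim (gap (m<m+n t 0<1+n) (+-monoʳ-< t |y⁺|<|u|) (occursAt-power-shift z t c y k o₁ o₂))
    where
    |y⁺|<|u| : length (c ∷ y) < length (concat (replicate (suc (suc k)) (c ∷ y)))
    |y⁺|<|u| = subst (length (c ∷ y) <_) (sym (length-++ (c ∷ y))) (m<m+n (length (c ∷ y)) 0<1+n)

module CoverSuffixTree {A : Set} (eqA : DecidableEquality A) (w : List A) where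

  private
    x : List (Maybe A)
    x = endmarked eqA w

    _occursAt_ : List (Maybe A) → ℕ → Set
    u occursAt i = OccursAt (eqM eqA) u x i

  explicit⇒factor : ∀ {v} → ExplicitCST eqA w v → Factor (eqM eqA) v x
  explicit⇒factor (inj₁ (inj₁ refl)) = 0 , refl
  explicit⇒factor {v} (inj₁ (inj₂ (inj₁ (p , e)))) = p , occursAt⁺ (eqM eqA) x p (trans e (sym (++-identityʳ v)))
  explicit⇒factor {v} (inj₁ (inj₂ (inj₂ (_ , _ , _ , (p , o) , _)))) = p , occursAt-prefix (eqM eqA) v x p o
  explicit⇒factor {v} (inj₂ (_ , p , o)) =
    p , occursAt-++ʳ (eqM eqA) (map just w) [ nothing ] p (occursAt-prefix (eqM eqA) v (map just w) p o)

  implicit⇒occurrences-≐ : ∀ {u a} → Factor (eqM eqA) (u ++ [ a ]) x → ¬ ExplicitST eqA w u →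
                           (u occursAt_) ≐ ((u ++ [ a ]) occursAt_)
  implicit⇒occurrences-≐ {u} {a} fac ¬explicit = (λ {p} → extend p) , λ {p} → occursAt-prefix (eqM eqA) u x p
    where
    extend : ∀ p → u occursAt p → (u ++ [ a ]) occursAt p
    extend p o with occursAt⁻ (eqM eqA) x p o
    ... | [] , e = ⊥-elim (¬explicit (inj₂ (inj₁ (p , trans e (++-identityʳ u)))))
    ... | b ∷ r , e with eqM eqA a b
    ...   | yes refl = occursAt⁺ (eqM eqA) x p (trans e (sym (++-assoc u [ b ] r)))
    ...   | no a≢b   = ⊥-elim (¬explicit (inj₂ (inj₂ (a , b , a≢b , fac , p ,
                         occursAt⁺ (eqM eqA) x p (trans e (sym (++-assoc u [ b ] r)))))))

  adjacent⇒extra : ∀ {u a} t → (u ++ [ a ]) occursAt t → (u ++ [ a ]) occursAt (t + length u) →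
                   (∀ {y} → t < y → y < t + length u → ¬ (u ++ [ a ]) occursAt y) → ExtraCST eqA w u
  adjacent⇒extra {u} {a} t o₁ o₂ gap = adjacent⇒primitive (eqM eqA) x t o₁ o₂ gap , t , square
    where
    square : OccursAt (eqM eqA) (u ++ u) (map just w) t
    square = occursAt-∷ʳ⁻ (eqM eqA) (map just w) t
      (subst (_occursAt t) (sym (++-assoc u u [ a ])) (occursAt-++ (eqM eqA) x t (occursAt-prefix (eqM eqA) u x t o₁) o₂))

  edge-step : ∀ u a → Factor (eqM eqA) (u ++ [ a ]) x → ¬ ExplicitCST eqA w u →
              cNode eqA w (u ++ [ a ]) ≡ cNode eqA w u + ΔNode eqA w (u ++ [ a ]) ×
              ΔNode eqA w u ≡ ΔNode eqA w (u ++ [ a ])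
  edge-step u a fac ¬explicit = cover , isolated
    where
    open ≡-Reasoning
    open Positions
    O?  = occursAt? (eqM eqA) u x
    O⁺? = occursAt? (eqM eqA) (u ++ [ a ]) x
    ℓ = length u
    n = length x

    same : (u occursAt_) ≐ ((u ++ [ a ]) occursAt_)
    same = implicit⇒occurrences-≐ fac (¬explicit ∘ inj₁)

    |u⁺|≡1+ℓ : length (u ++ [ a ]) ≡ suc ℓ
    |u⁺|≡1+ℓ = trans (length-++ u) (+-comm ℓ 1)

    bound : ∀ {p} → (u ++ [ a ]) occursAt p → p + suc ℓ ≤ n
    bound {p} o = subst (λ m → p + m ≤ n) |u⁺|≡1+ℓ (occursAt-bound (eqM eqA) x p o (subst (0 <_) (sym |u⁺|≡1+ℓ) 0<1+n))

    noAdjacent : ∀ {p} → (u ++ [ a ]) occursAt p → Isolated O⁺? ℓ p → ¬ (u ++ [ a ]) occursAt (p + ℓ)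
    noAdjacent {p} o iso o′ = ¬explicit (inj₂ (adjacent⇒extra p o o′ (λ {y} → isolated⁻ O⁺? iso)))

    cover : cNode eqA w (u ++ [ a ]) ≡ cNode eqA w u + ΔNode eqA w (u ++ [ a ])
    cover = begin
      coverCount O⁺? (length (u ++ [ a ])) n                   ≡⟨ cong (λ m → coverCount O⁺? m n) |u⁺|≡1+ℓ ⟩
      coverCount O⁺? (suc ℓ) n                                 ≡⟨ coverCount-suc O⁺? ℓ bound (n≤1+n n) ⟩
      coverCount O⁺? ℓ n + isolatedCount O⁺? (suc ℓ) (suc n)   ≡⟨ cong₂ _+_ (sym (coverCount-≐ O? O⁺? same ℓ n))
                                                                            (cong (λ m → isolatedCount O⁺? m (suc n)) (sym |u⁺|≡1+ℓ)) ⟩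
      coverCount O? ℓ n + isolatedCount O⁺? (length (u ++ [ a ])) (suc n) ∎

    isolated : ΔNode eqA w u ≡ ΔNode eqA w (u ++ [ a ])
    isolated = begin
      isolatedCount O? ℓ (suc n)                           ≡⟨ isolatedCount-≐ O? O⁺? same ℓ (suc n) ⟩
      isolatedCount O⁺? ℓ (suc n)                          ≡⟨ isolatedCount-suc O⁺? ℓ (suc n) noAdjacent ⟨
      isolatedCount O⁺? (suc ℓ) (suc n)                    ≡⟨ cong (λ m → isolatedCount O⁺? m (suc n)) |u⁺|≡1+ℓ ⟨
      isolatedCount O⁺? (length (u ++ [ a ])) (suc n)      ∎

  edge-chain : ∀ u s → Factor (eqM eqA) (u ++ s) x → (∀ j → j < length s → ¬ ExplicitCST eqA w (u ++ take j s)) →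
               cNode eqA w u + length s * ΔNode eqA w (u ++ s) ≡ cNode eqA w (u ++ s) ×
               ΔNode eqA w u ≡ ΔNode eqA w (u ++ s)
  edge-chain u [] _ _ rewrite ++-identityʳ u = +-identityʳ _ , refl
  edge-chain u (b ∷ s) (p , o) implicit = cover , isolated
    where
    open ≡-Reasoning
    v : List (Maybe A)
    v = u ++ b ∷ s
    assoc : ∀ s′ → (u ++ [ b ]) ++ s′ ≡ u ++ b ∷ s′
    assoc = ++-assoc u [ b ]

    step : cNode eqA w (u ++ [ b ]) ≡ cNode eqA w u + ΔNode eqA w (u ++ [ b ]) ×
           ΔNode eqA w u ≡ ΔNode eqA w (u ++ [ b ])
    step = edge-step u b (p , occursAt-prefix (eqM eqA) (u ++ [ b ]) x p (subst (_occursAt p) (sym (assoc s)) o))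
                     (subst (λ u′ → ¬ ExplicitCST eqA w u′) (++-identityʳ u) (implicit 0 0<1+n))

    rest : cNode eqA w (u ++ [ b ]) + length s * ΔNode eqA w v ≡ cNode eqA w v ×
           ΔNode eqA w (u ++ [ b ]) ≡ ΔNode eqA w v
    rest = subst (λ v′ → cNode eqA w (u ++ [ b ]) + length s * ΔNode eqA w v′ ≡ cNode eqA w v′ ×
                         ΔNode eqA w (u ++ [ b ]) ≡ ΔNode eqA w v′) (assoc s)
      (edge-chain (u ++ [ b ]) s (p , subst (_occursAt p) (sym (assoc s)) o)
        λ j j<|s| → subst (λ u′ → ¬ ExplicitCST eqA w u′) (sym (assoc (take j s))) (implicit (suc j) (s≤s j<|s|)))

    cover : cNode eqA w u + suc (length s) * ΔNode eqA w v ≡ cNode eqA w v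
    cover = begin
      cNode eqA w u + (ΔNode eqA w v + length s * ΔNode eqA w v)  ≡⟨ +-assoc (cNode eqA w u) _ _ ⟨
      cNode eqA w u + ΔNode eqA w v + length s * ΔNode eqA w v    ≡⟨ cong (λ d → cNode eqA w u + d + length s * ΔNode eqA w v) (proj₂ rest) ⟨
      cNode eqA w u + ΔNode eqA w (u ++ [ b ]) + length s * ΔNode eqA w v ≡⟨ cong (_+ length s * ΔNode eqA w v) (proj₁ step) ⟨
      cNode eqA w (u ++ [ b ]) + length s * ΔNode eqA w v         ≡⟨ proj₁ rest ⟩
      cNode eqA w v                                               ∎

    isolated : ΔNode eqA w u ≡ ΔNode eqA w v
    isolated = trans (proj₂ step) (proj₂ rest)

lemma1 : {A : Set} (eqA : DecidableEquality A) (w : List A) (v : List (Maybe A)) →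
    ExplicitCST eqA w v → v ≢ [] →
    (i : ℕ) → 1 ≤ i →
    (∀ (j : ℕ) → 1 ≤ j → j ≤ i → ¬ ExplicitCST eqA w (take (length v ∸ j) v)) →
    cNode eqA w (take (length v ∸ i) v) + i * ΔNode eqA w v ≡ cNode eqA w v
lemma1 eqA w v explicit _ i 1≤i implicit =
  subst₂ (λ k v′ → cNode eqA w u + k * ΔNode eqA w v′ ≡ cNode eqA w v′) |s|≡i (take++drop≡id (m ∸ i) v)
    (proj₁ (edge-chain u s factor implicit′))
  where
  open CoverSuffixTree eqA w
  m = length v
  u = take (m ∸ i) v
  s = drop (m ∸ i) v

  i<m : i < m
  i<m = m∸n≢0⇒n<m λ m∸i≡0 → implicit i 1≤i ≤-refl (inj₁ (inj₁ (cong (λ k → take k v) m∸i≡0)))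

  |s|≡i : length s ≡ i
  |s|≡i = trans (length-drop (m ∸ i) v) (m∸[m∸n]≡n (<⇒≤ i<m))

  factor : Factor (eqM eqA) (u ++ s) (endmarked eqA w)
  factor = subst (λ v′ → Factor (eqM eqA) v′ (endmarked eqA w)) (sym (take++drop≡id (m ∸ i) v)) (explicit⇒factor explicit)

  implicit′ : ∀ j → j < length s → ¬ ExplicitCST eqA w (u ++ take j s)
  implicit′ j j<|s| = implicit (i ∸ j) (m<n⇒0<n∸m j<i) (m∸n≤m i j) ∘ subst (ExplicitCST eqA w) prefix
    where
    j<i : j < i
    j<i = subst (j <_) |s|≡i j<|s|
    prefix : u ++ take j s ≡ take (m ∸ (i ∸ j)) v
    prefix = trans (sym (take-+ (m ∸ i) j v)) (cong (λ k → take k v) (sym (m∸[n∸o]≡m∸n+o (<⇒≤ j<i) (<⇒≤ i<m))))
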